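{- Let $r\ge 0$ be an integer, $R=2^r$, $W=\sqrt{R^2+2R}$, $\lambda=\frac{R+W}{2}$, $\mu=\frac{R-W}{2}$, and for every integer $n$ let $P_R(n)=\frac{2}{RW}(\lambda^n-\mu^n)$. Then for all integers $m\ge 1$ and $n\ge 0$, \[ 2^mP_R((n+2)m)-\Bigl(R(R+1)2^{m-1}P_R(m)-R^22^{m-2}P_R(m-2)\Bigr)P_R((n+1)m)+(-1)^mR^mP_R(nm)=0 . \]
   Context: $P_R(n)$ are the (shifted) generalized $r$-Pell numbers; they satisfy $2P_R(n+2)-2RP_R(n+1)-RP_R(n)=0$ with $P_R(0)=0$, $P_R(1)=2/R$, $P_R(2)=2$. The Binet formula defines $P_R(n)$ also for negative $n$ (e.g. $P_R(-1)=4/R^2$, which is used when $m=1$). -}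

module Defs where

open import Data.Nat as ℕ using (ℕ; zero; suc)
open import Data.Nat.Properties using (m^n≢0)
open import Data.Integer as ℤ using (ℤ; +_; -[1+_])
open import Data.Rational using (ℚ; _/_; _+_; _*_; _-_; 0ℚ; 1ℚ)

_^ℚ_ : ℚ → ℕ → ℚ
q ^ℚ zero  = 1ℚ
q ^ℚ suc n = q * (q ^ℚ n)

Rq : ℕ → ℚ
Rq r = + (2 ℕ.^ r) / 1

invR : ℕ → ℚ
invR r = _/_ (+ 1) (2 ℕ.^ r) {{m^n≢0 2 r}}

Pnat : ℕ → ℕ → ℚ
Pnat r zero = 0ℚ
Pnat r (suc zero) = (+ 2 / 1) * invR r
Pnat r (suc (suc n)) = Rq r * Pnat r (suc n) + (Rq r * (+ 1 / 2)) * Pnat r n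

-- Q r k = P_R(1 - k), obtained by running the recurrence backwards:
-- P(n) = (2P(n+2) - 2R P(n+1)) / R
Qback : ℕ → ℕ → ℚ
Qback r zero = Pnat r 1
Qback r (suc zero) = Pnat r 0
Qback r (suc (suc k)) =
  ((+ 2 / 1) * Qback r k - (+ 2 / 1) * Rq r * Qback r (suc k)) * invR r

-- P_R on all integers (agrees with the Binet formula, which satisfies the same
-- recurrence and initial values; e.g. P_R(-1) = 4/R^2)
P : ℕ → ℤ → ℚ
P r (+ n) = Pnat r n
P r -[1+ k ] = Qback r (suc (suc k))

{-# OPTIONS --safe #-}
module Submission where

-- Every solution f of f (k + 2) = p f (k + 1) + q f k is a combination of the two
-- fundamental solutions e₁ (0, 1, …) and e₀ (1, 0, …): f (k + M) = e₁ k f (M + 1) + e₀ k f M.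
-- Applying this twice, the dilated sequence j ↦ f (j m) satisfies a recurrence of the same
-- shape with trace e₁ (m + 1) + e₀ m and, by the Cassini identity, constant term (-q)^m.
-- For P_R we have p = R and q = R/2; multiplying by 2^m and expressing the trace through
-- P_R(m) and P_R(m - 2) gives the stated identity.

open import Defs
open import Data.Nat as ℕ using (ℕ; _≤_; zero; suc; s≤s; NonZero)
open import Data.Nat.Properties using (m^n≢0; +-identityʳ; +-comm)
import Data.Nat.Coprimality as Coprime
open import Data.Integer using (+_) renaming (_+_ to _+ℤ_; _*_ to _*ℤ_; _-_ to _-ℤ_)
open import Data.Integer.Properties using (pos-*)
open import Data.Rational using (ℚ; _/_; _+_; _*_; _-_; -_; 0ℚ; 1ℚ; mkℚ)
open import Data.Rational.Properties using (normalize-coprime; *-inverseʳ; *-zeroʳ)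
open import Data.Rational.Solver using (module +-*-Solver)
open import Relation.Binary.PropositionalEquality using (_≡_; refl; sym; trans; cong; cong₂)
open Relation.Binary.PropositionalEquality.≡-Reasoning
open +-*-Solver

^ℚ-distribʳ-* : ∀ x y m → (x * y) ^ℚ m ≡ x ^ℚ m * y ^ℚ m
^ℚ-distribʳ-* x y zero = refl
^ℚ-distribʳ-* x y (suc m) = begin
  (x * y) * (x * y) ^ℚ m         ≡⟨ cong ((x * y) *_) (^ℚ-distribʳ-* x y m) ⟩
  (x * y) * (x ^ℚ m * y ^ℚ m)    ≡⟨ solve 4 (λ x y u v → (x :* y) :* (u :* v) := (x :* u) :* (y :* v))
                                            refl x y (x ^ℚ m) (y ^ℚ m) ⟩
  (x * x ^ℚ m) * (y * y ^ℚ m)    ∎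

n/1*1/n≡1 : ∀ n .{{_ : NonZero n}} → (+ n / 1) * (+ 1 / n) ≡ 1ℚ
n/1*1/n≡1 (suc k)
  rewrite normalize-coprime {suc k} {0} (Coprime.sym (Coprime.1-coprimeTo (suc k)))
        | normalize-coprime {1} {k} (Coprime.1-coprimeTo (suc k))
  = *-inverseʳ (mkℚ (+ suc k) 0 (Coprime.sym (Coprime.1-coprimeTo (suc k))))

module LinearRecurrence (p q : ℚ) where

  Solution : (ℕ → ℚ) → Set
  Solution f = ∀ k → f (suc (suc k)) ≡ p * f (suc k) + q * f k

  e₀ e₁ : ℕ → ℚ
  e₀ zero          = 1ℚ
  e₀ (suc zero)    = 0ℚ
  e₀ (suc (suc k)) = p * e₀ (suc k) + q * e₀ k
  e₁ zero          = 0ℚ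
  e₁ (suc zero)    = 1ℚ
  e₁ (suc (suc k)) = p * e₁ (suc k) + q * e₁ k

  trace : ℕ → ℚ
  trace m = e₁ (suc m) + e₀ m

  e₀-suc : ∀ k → e₀ (suc k) ≡ q * e₁ k
  e₀-suc zero = solve 1 (λ q → con 0ℚ := q :* con 0ℚ) refl q
  e₀-suc (suc zero) = solve 2 (λ p q → p :* con 0ℚ :+ q :* con 1ℚ := q :* con 1ℚ) refl p q
  e₀-suc (suc (suc k)) = begin
    p * e₀ (suc (suc k)) + q * e₀ (suc k)
      ≡⟨ cong₂ (λ u v → p * u + q * v) (e₀-suc (suc k)) (e₀-suc k) ⟩
    p * (q * e₁ (suc k)) + q * (q * e₁ k)
      ≡⟨ solve 4 (λ p q x y → p :* (q :* x) :+ q :* (q :* y) := q :* (p :* x :+ q :* y))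
           refl p q (e₁ (suc k)) (e₁ k) ⟩
    q * e₁ (suc (suc k)) ∎

  trace-suc : ∀ k → trace (suc k) ≡ p * e₁ (suc k) + (q + q) * e₁ k
  trace-suc k = begin
    e₁ (suc (suc k)) + e₀ (suc k)   ≡⟨ cong (λ z → e₁ (suc (suc k)) + z) (e₀-suc k) ⟩
    e₁ (suc (suc k)) + q * e₁ k     ≡⟨ solve 4 (λ p q x y → (p :* x :+ q :* y) :+ q :* y
                                                        := p :* x :+ (q :+ q) :* y)
                                         refl p q (e₁ (suc k)) (e₁ k) ⟩
    p * e₁ (suc k) + (q + q) * e₁ k ∎

  cassini : ∀ m → e₁ (suc m) * e₀ m - e₁ m * e₀ (suc m) ≡ (- q) ^ℚ m
  cassini zero = refl
  cassini (suc m) = begin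
    e₁ (suc (suc m)) * e₀ (suc m) - e₁ (suc m) * e₀ (suc (suc m))
      ≡⟨ solve 6 (λ p q a₁ a₀ b₁ b₀ →
                    (p :* a₁ :+ q :* a₀) :* b₁ :- a₁ :* (p :* b₁ :+ q :* b₀)
                 := (:- q) :* (a₁ :* b₀ :- a₀ :* b₁))
           refl p q (e₁ (suc m)) (e₁ m) (e₀ (suc m)) (e₀ m) ⟩
    (- q) * (e₁ (suc m) * e₀ m - e₁ m * e₀ (suc m))   ≡⟨ cong ((- q) *_) (cassini m) ⟩
    (- q) ^ℚ suc m                                     ∎

  module _ {f : ℕ → ℚ} (sol : Solution f) where

    shift : ∀ k M → f (k ℕ.+ M) ≡ e₁ k * f (suc M) + e₀ k * f M
    shift zero M = solve 2 (λ x y → y := con 0ℚ :* x :+ con 1ℚ :* y) refl (f (suc M)) (f M)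
    shift (suc zero) M = solve 2 (λ x y → x := con 1ℚ :* x :+ con 0ℚ :* y) refl (f (suc M)) (f M)
    shift (suc (suc k)) M = begin
      f (suc (suc (k ℕ.+ M)))                                   ≡⟨ sol (k ℕ.+ M) ⟩
      p * f (suc k ℕ.+ M) + q * f (k ℕ.+ M)
        ≡⟨ cong₂ (λ u v → p * u + q * v) (shift (suc k) M) (shift k M) ⟩
      p * (e₁ (suc k) * x + e₀ (suc k) * y) + q * (e₁ k * x + e₀ k * y)
        ≡⟨ solve 8 (λ p q a₁ a₀ b₁ b₀ x y →
                      p :* (a₁ :* x :+ b₁ :* y) :+ q :* (a₀ :* x :+ b₀ :* y)
                   := (p :* a₁ :+ q :* a₀) :* x :+ (p :* b₁ :+ q :* b₀) :* y)
             refl p q (e₁ (suc k)) (e₁ k) (e₀ (suc k)) (e₀ k) x y ⟩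
      e₁ (suc (suc k)) * x + e₀ (suc (suc k)) * y               ∎
      where
      x y : ℚ
      x = f (suc M)
      y = f M

    solution-from-zero : f 0 ≡ 0ℚ → ∀ k → f k ≡ e₁ k * f 1
    solution-from-zero f0≡0 k = begin
      f k                       ≡⟨ cong f (sym (+-identityʳ k)) ⟩
      f (k ℕ.+ 0)               ≡⟨ shift k 0 ⟩
      e₁ k * f 1 + e₀ k * f 0   ≡⟨ cong (λ z → e₁ k * f 1 + e₀ k * z) f0≡0 ⟩
      e₁ k * f 1 + e₀ k * 0ℚ    ≡⟨ solve 3 (λ a b x → a :* x :+ b :* con 0ℚ := a :* x)
                                            refl (e₁ k) (e₀ k) (f 1) ⟩
      e₁ k * f 1                ∎

    dilation : ∀ m N → f (m ℕ.+ (m ℕ.+ N)) - trace m * f (m ℕ.+ N) + (- q) ^ℚ m * f N ≡ 0ℚ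
    dilation m N = begin
      f (m ℕ.+ (m ℕ.+ N)) - trace m * f (m ℕ.+ N) + (- q) ^ℚ m * f N
        ≡⟨ cong₂ (λ u v → u - trace m * v + (- q) ^ℚ m * y) outer inner ⟩
      double - trace m * (e₁ m * x + e₀ m * y) + (- q) ^ℚ m * y
        ≡⟨ cong (λ c → double - trace m * (e₁ m * x + e₀ m * y) + c * y) (sym (cassini m)) ⟩
      double - trace m * (e₁ m * x + e₀ m * y) + (e₁ (suc m) * e₀ m - e₁ m * e₀ (suc m)) * y
        ≡⟨ solve 6 (λ a a' b b' x y →
                      (a :* (a' :* x :+ b' :* y) :+ b :* (a :* x :+ b :* y))
                      :- (a' :+ b) :* (a :* x :+ b :* y) :+ (a' :* b :- a :* b') :* y
                   := con 0ℚ)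
             refl (e₁ m) (e₁ (suc m)) (e₀ m) (e₀ (suc m)) x y ⟩
      0ℚ ∎
      where
      x y double : ℚ
      x = f (suc N)
      y = f N
      inner : f (m ℕ.+ N) ≡ e₁ m * x + e₀ m * y
      inner = shift m N
      double = e₁ m * (e₁ (suc m) * x + e₀ (suc m) * y) + e₀ m * (e₁ m * x + e₀ m * y)
      outer : f (m ℕ.+ (m ℕ.+ N)) ≡ double
      outer = begin
        f (m ℕ.+ (m ℕ.+ N))                                  ≡⟨ shift m (m ℕ.+ N) ⟩
        e₁ m * f (suc m ℕ.+ N) + e₀ m * f (m ℕ.+ N)
          ≡⟨ cong₂ (λ u v → e₁ m * u + e₀ m * v) (shift (suc m) N) inner ⟩
        double ∎


R*invR≡1 : ∀ r → Rq r * invR r ≡ 1ℚ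
R*invR≡1 r = n/1*1/n≡1 (2 ℕ.^ r) {{m^n≢0 2 r}}

[-1]^m*x^m≡2^m*[-x/2]^m : ∀ x m → (- 1ℚ) ^ℚ m * x ^ℚ m ≡ (+ 2 / 1) ^ℚ m * (- (x * (+ 1 / 2))) ^ℚ m
[-1]^m*x^m≡2^m*[-x/2]^m x m = begin
  (- 1ℚ) ^ℚ m * x ^ℚ m                 ≡⟨ sym (^ℚ-distribʳ-* (- 1ℚ) x m) ⟩
  ((- 1ℚ) * x) ^ℚ m                    ≡⟨ cong (_^ℚ m) (solve 1 (λ x → con (- 1ℚ) :* x
                                                                 := con (+ 2 / 1) :* (:- (x :* con (+ 1 / 2))))
                                                          refl x) ⟩
  ((+ 2 / 1) * (- (x * (+ 1 / 2)))) ^ℚ m ≡⟨ ^ℚ-distribʳ-* (+ 2 / 1) (- (x * (+ 1 / 2))) m ⟩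
  (+ 2 / 1) ^ℚ m * (- (x * (+ 1 / 2))) ^ℚ m ∎

coefficient : ℕ → ℕ → ℚ
coefficient r m = Rq r * (Rq r + 1ℚ) * ((+ 2 / 1) ^ℚ m * (+ 1 / 2)) * P r (+ m)
                  - Rq r ^ℚ 2 * ((+ 2 / 1) ^ℚ m * (+ 1 / 4)) * P r (+ m -ℤ + 2)

module _ (r : ℕ) where
  open LinearRecurrence (Rq r) (Rq r * (+ 1 / 2))

  Pnat-solution : Solution (Pnat r)
  Pnat-solution k = refl

  Pnat≡e₁*P1 : ∀ k → Pnat r k ≡ e₁ k * Pnat r 1
  Pnat≡e₁*P1 = solution-from-zero Pnat-solution refl

  coefficient≡2^m*trace : ∀ k → coefficient r (suc k) ≡ (+ 2 / 1) ^ℚ suc k * trace (suc k)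
  -- For m = 1 the term P_R(m - 2) = P_R(-1) = 4/R² unfolds through the backward recurrence.
  coefficient≡2^m*trace zero = begin
    R * (R + 1ℚ) * (T * h) * ((+ 2 / 1) * i)
      - R * (R * 1ℚ) * (T * (+ 1 / 4)) * (((+ 2 / 1) * ((+ 2 / 1) * i) - (+ 2 / 1) * R * 0ℚ) * i)
      ≡⟨ solve 3 (λ R i T →
                    R :* (R :+ con 1ℚ) :* (T :* con h) :* (con (+ 2 / 1) :* i)
                    :- R :* (R :* con 1ℚ) :* (T :* con (+ 1 / 4))
                       :* ((con (+ 2 / 1) :* (con (+ 2 / 1) :* i) :- con (+ 2 / 1) :* R :* con 0ℚ) :* i)
                 := T :* ((R :* i) :* (R :+ con 1ℚ) :- (R :* i) :* (R :* i)))
           refl R i T ⟩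
    T * ((R * i) * (R + 1ℚ) - (R * i) * (R * i))
      ≡⟨ cong (λ z → T * (z * (R + 1ℚ) - z * z)) (R*invR≡1 r) ⟩
    T * (1ℚ * (R + 1ℚ) - 1ℚ * 1ℚ)
      ≡⟨ solve 2 (λ R T → T :* (con 1ℚ :* (R :+ con 1ℚ) :- con 1ℚ :* con 1ℚ)
                       := T :* (R :* con 1ℚ :+ (R :* con h :+ R :* con h) :* con 0ℚ))
           refl R T ⟩
    T * (R * e₁ 1 + (q + q) * e₁ 0)   ≡⟨ cong (T *_) (sym (trace-suc 0)) ⟩
    T * trace 1                        ∎
    where
    R i T h q : ℚ
    R = Rq r
    i = invR r
    T = (+ 2 / 1) ^ℚ 1
    h = + 1 / 2
    q = R * h
  coefficient≡2^m*trace (suc j) = begin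
    R * (R + 1ℚ) * (T * h) * Pnat r m - R * (R * 1ℚ) * (T * (+ 1 / 4)) * Pnat r j
      ≡⟨ cong₂ (λ u v → R * (R + 1ℚ) * (T * h) * u - R * (R * 1ℚ) * (T * (+ 1 / 4)) * v)
               (Pnat≡e₁*P1 m) (Pnat≡e₁*P1 j) ⟩
    R * (R + 1ℚ) * (T * h) * (e₁ m * ((+ 2 / 1) * i))
      - R * (R * 1ℚ) * (T * (+ 1 / 4)) * (e₁ j * ((+ 2 / 1) * i))
      ≡⟨ solve 5 (λ R i T x y →
                    R :* (R :+ con 1ℚ) :* (T :* con h) :* (x :* (con (+ 2 / 1) :* i))
                    :- R :* (R :* con 1ℚ) :* (T :* con (+ 1 / 4)) :* (y :* (con (+ 2 / 1) :* i))
                 := (R :* i) :* (T :* ((R :+ con 1ℚ) :* x :- (R :* con h) :* y)))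
           refl R i T (e₁ m) (e₁ j) ⟩
    (R * i) * (T * ((R + 1ℚ) * e₁ m - q * e₁ j))
      ≡⟨ cong (λ z → z * (T * ((R + 1ℚ) * e₁ m - q * e₁ j))) (R*invR≡1 r) ⟩
    1ℚ * (T * ((R + 1ℚ) * e₁ m - q * e₁ j))
      ≡⟨ solve 4 (λ R T x y →
                    con 1ℚ :* (T :* ((R :+ con 1ℚ) :* (R :* x :+ (R :* con h) :* y) :- (R :* con h) :* y))
                 := T :* (R :* (R :* x :+ (R :* con h) :* y) :+ (R :* con h :+ R :* con h) :* x))
           refl R T (e₁ (suc j)) (e₁ j) ⟩
    T * (R * e₁ m + (q + q) * e₁ (suc j))   ≡⟨ cong (T *_) (sym (trace-suc (suc j))) ⟩
    T * trace m                             ∎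
    where
    m : ℕ
    m = suc (suc j)
    R i T h q : ℚ
    R = Rq r
    i = invR r
    T = (+ 2 / 1) ^ℚ m
    h = + 1 / 2
    q = R * h

  P-at-multiple : ∀ j m → P r (+ j *ℤ + m) ≡ Pnat r (j ℕ.* m)
  P-at-multiple j m = cong (P r) (sym (pos-* j m))

  P-at-multiple-+ : ∀ i j m → P r ((+ j +ℤ + i) *ℤ + m) ≡ Pnat r ((i ℕ.+ j) ℕ.* m)
  P-at-multiple-+ i j m = trans (P-at-multiple (j ℕ.+ i) m) (cong (λ k → Pnat r (k ℕ.* m)) (+-comm j i))

mainTheorem1 : (r m n : ℕ) → 1 ≤ m →
    (+ 2 / 1) ^ℚ m * P r ((+ n +ℤ + 2) *ℤ + m)
    - (Rq r * (Rq r + 1ℚ) * ((+ 2 / 1) ^ℚ m * (+ 1 / 2)) * P r (+ m)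
    - Rq r ^ℚ 2 * ((+ 2 / 1) ^ℚ m * (+ 1 / 4)) * P r (+ m -ℤ + 2))
    * P r ((+ n +ℤ + 1) *ℤ + m)
    + (- 1ℚ) ^ℚ m * Rq r ^ℚ m * P r (+ n *ℤ + m)
    ≡ 0ℚ
mainTheorem1 r m@(suc k) n (s≤s _) = begin
  T * P r ((+ n +ℤ + 2) *ℤ + m) - coefficient r m * P r ((+ n +ℤ + 1) *ℤ + m)
    + (- 1ℚ) ^ℚ m * Rq r ^ℚ m * P r (+ n *ℤ + m)
    ≡⟨ cong₂ (λ u v → T * u - v + (- 1ℚ) ^ℚ m * Rq r ^ℚ m * P r (+ n *ℤ + m))
             (P-at-multiple-+ r 2 n m)
             (cong₂ _*_ (coefficient≡2^m*trace r k) (P-at-multiple-+ r 1 n m)) ⟩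
  T * f (m ℕ.+ (m ℕ.+ N)) - (T * trace m) * f (m ℕ.+ N) + (- 1ℚ) ^ℚ m * Rq r ^ℚ m * P r (+ n *ℤ + m)
    ≡⟨ cong₂ (λ u v → T * f (m ℕ.+ (m ℕ.+ N)) - (T * trace m) * f (m ℕ.+ N) + u * v)
             ([-1]^m*x^m≡2^m*[-x/2]^m (Rq r) m) (P-at-multiple r n m) ⟩
  T * f (m ℕ.+ (m ℕ.+ N)) - (T * trace m) * f (m ℕ.+ N) + (T * (- q) ^ℚ m) * f N
    ≡⟨ solve 6 (λ T t c x y z → T :* x :- (T :* t) :* y :+ (T :* c) :* z := T :* (x :- t :* y :+ c :* z))
         refl T (trace m) ((- q) ^ℚ m) (f (m ℕ.+ (m ℕ.+ N))) (f (m ℕ.+ N)) (f N) ⟩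
  T * (f (m ℕ.+ (m ℕ.+ N)) - trace m * f (m ℕ.+ N) + (- q) ^ℚ m * f N)
    ≡⟨ cong (T *_) (dilation (Pnat-solution r) m N) ⟩
  T * 0ℚ ≡⟨ *-zeroʳ T ⟩
  0ℚ ∎
  where
  q T : ℚ
  q = Rq r * (+ 1 / 2)
  T = (+ 2 / 1) ^ℚ m
  open LinearRecurrence (Rq r) q
  N : ℕ
  N = n ℕ.* m
  f : ℕ → ℚ
  f = Pnat r
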